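{- Let $q \geq 3$, let $n\ge 1$, and let $T$ be any tree on $n$ vertices. Then \[ \chi_{2scf}(P_n;q) \leq \chi_{2scf}(T;q), \] with equality if and only if $T=P_n$.
   Context: $P_n$ denotes the path on $n$ vertices. For a graph $G$ and $v\in V(G)$, $N[v]$ is the closed neighborhood of $v$. A 2-strong-conflict-free coloring of $G$ with $q$ colors is a function $c:V(G)\to\{1,\ldots,q\}$ such that for every $v\in V(G)$ there are at least two colors each of which occurs exactly once among the vertices of $N[v]$. $\chi_{2scf}(G;q)$ denotes the number of 2-strong-conflict-free colorings of $G$ with $q$ colors. -}

module Defs where

open import Data.Bool using (Bool; true; false; _∨_; _∧_; if_then_else_)
open import Data.Bool.Properties using (∨-comm)
open import Data.Nat using (ℕ; zero; suc; _≤_; _≤?_; _≡ᵇ_)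
open import Data.Fin using (Fin; toℕ; _≟_)
open import Data.Fin.Properties using (all?)
open import Data.Fin.Permutation using (Permutation; _⟨$⟩ʳ_)
open import Data.List using (List; []; _∷_; length; filter; map; concatMap; allFin)
open import Data.List.Relation.Unary.Unique.Propositional using (Unique)
open import Data.Vec using (Vec; lookup) renaming ([] to []ᵥ; _∷_ to _∷ᵥ_)
open import Data.Product using (Σ; _×_; ∃)
open import Relation.Nullary using (¬_; Dec; yes; no)
open import Relation.Nullary.Decidable using (_⊎-dec_; _×-dec_)
open import Relation.Binary.PropositionalEquality using (_≡_; refl)
open import Data.Sum using (_⊎_)

record Graph (n : ℕ) : Set where
  field
    adj      : Fin n → Fin n → Bool
    adj-sym  : ∀ i j → adj i j ≡ adj j i
    adj-irr  : ∀ i → adj i i ≡ false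
open Graph public

data Walk {n : ℕ} (G : Graph n) : Fin n → Fin n → Set where
  here : ∀ {u} → Walk G u u
  step : ∀ {u w v} → adj G u w ≡ true → Walk G w v → Walk G u v

Connected : ∀ {n} → Graph n → Set
Connected {n} G = (u v : Fin n) → Walk G u v

ClosedFrom : ∀ {n} → Graph n → Fin n → List (Fin n) → Fin n → Set
ClosedFrom G x []       t = adj G x t ≡ true
ClosedFrom G x (y ∷ ys) t = (adj G x y ≡ true) × ClosedFrom G y ys t

record Cycle {n : ℕ} (G : Graph n) : Set where
  field
    start  : Fin n
    rest   : List (Fin n)
    unique : Unique (start ∷ rest)
    long   : 2 ≤ length rest
    closed : ClosedFrom G start rest start

Acyclic : ∀ {n} → Graph n → Set
Acyclic G = ¬ Cycle G

IsTree : ∀ {n} → Graph n → Set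
IsTree G = Connected G × Acyclic G

private
  suc≢ : ∀ m → (suc m ≡ᵇ m) ≡ false
  suc≢ zero    = refl
  suc≢ (suc m) = suc≢ m

  irrP : ∀ m → ((suc m ≡ᵇ m) ∨ (suc m ≡ᵇ m)) ≡ false
  irrP m rewrite suc≢ m = refl

P : (n : ℕ) → Graph n
P n = record
  { adj     = λ i j → (suc (toℕ i) ≡ᵇ toℕ j) ∨ (suc (toℕ j) ≡ᵇ toℕ i)
  ; adj-sym = λ i j → ∨-comm (suc (toℕ i) ≡ᵇ toℕ j) (suc (toℕ j) ≡ᵇ toℕ i)
  ; adj-irr = λ i → irrP (toℕ i)
  }

-- Graph isomorphism (T = P_n up to isomorphism).
_≅_ : ∀ {n} → Graph n → Graph n → Set
_≅_ {n} G H = Σ (Permutation n n) λ π →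
  ∀ i j → adj G (π ⟨$⟩ʳ i) (π ⟨$⟩ʳ j) ≡ adj H i j

InClosedNbhd : ∀ {n} → Graph n → Fin n → Fin n → Set
InClosedNbhd G v u = (u ≡ v) ⊎ (adj G v u ≡ true)

inClosedNbhd? : ∀ {n} (G : Graph n) (v u : Fin n) → Dec (InClosedNbhd G v u)
inClosedNbhd? G v u = (u ≟ v) ⊎-dec (Data.Bool._≟_ (adj G v u) true)
  where import Data.Bool

occ : ∀ {n q} → Graph n → (Fin n → Fin q) → Fin n → Fin q → ℕ
occ {n} G c v k =
  length (filter (λ u → inClosedNbhd? G v u ×-dec (c u ≟ k)) (allFin n))

uniqueColours : ∀ {n q} → Graph n → (Fin n → Fin q) → Fin n → ℕ
uniqueColours {n} {q} G c v =
  length (filter (λ k → Data.Nat._≟_ (occ G c v k) 1) (allFin q))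
  where import Data.Nat

Is2SCF : ∀ {n q} → Graph n → (Fin n → Fin q) → Set
Is2SCF {n} G c = (v : Fin n) → 2 ≤ uniqueColours G c v

is2SCF? : ∀ {n q} (G : Graph n) (c : Fin n → Fin q) → Dec (Is2SCF G c)
is2SCF? G c = all? (λ v → 2 ≤? uniqueColours G c v)

allVecs : (n q : ℕ) → List (Vec (Fin q) n)
allVecs zero    q = []ᵥ ∷ []
allVecs (suc n) q = concatMap (λ k → map (k ∷ᵥ_) (allVecs n q)) (allFin q)

χ2scf : ∀ {n} → Graph n → (q : ℕ) → ℕ
χ2scf {n} G q = length (filter (λ v → is2SCF? G (lookup v)) (allVecs n q))

module Submission where

-- Root T at a leaf and list its vertices as S 0, …, S (n-1) so that every
-- i > 0 has a parent p i < i and the edges of T are exactly the parent edges.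
-- A colouring of P n is 2-scf iff any three consecutive colours C (i-2),
-- C (i-1), C i are distinct.  Such a C is transported to T position by
-- position: D i is the image of C i under a colour permutation sending
-- C (i-1) to D (p i) and C (i-2) to D (partner (p i)), where the partner of
-- a vertex is its parent (vertex 1 for the root).  Then D is proper and the
-- partner of every vertex has a colour repeated by no other neighbour, so D
-- is 2-scf on T; the transport is injective, giving the inequality.  If some
-- non-root vertex b has two children c₁, c₂, a 2-scf colouring of T giving
-- c₁ the colour of the parent of b is not a transport (this uses q ≥ 3), so
-- the inequality is strict.  Otherwise every parent is the previous vertex
-- and the ordering is an isomorphism P n ≅ T.

open import Defs
open import Data.Bool using (Bool; true; false)
open import Data.Bool.Properties using (T-≡; T-∨)
open import Data.Empty using (⊥; ⊥-elim)
open import Data.Fin using (Fin; toℕ; fromℕ<)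
open import Data.Fin.Patterns using (0F; 1F; 2F)
open import Data.Fin.Permutation using (Permutation; permutation; _⟨$⟩ʳ_; _⟨$⟩ˡ_; inverseˡ; inverseʳ)
import Data.Fin.Permutation as Perm
open import Data.Fin.Permutation.Components using (transpose; transpose-inverse)
open import Data.Fin.Properties using (_≟_; any?; toℕ<n; toℕ-injective; toℕ-fromℕ<; injective⇒≤)
open import Data.List using (List; []; _∷_; _++_; length; filter; map; concatMap; allFin; cartesianProductWith)
open import Data.List.Membership.Propositional using (_∈_)
open import Data.List.Membership.Propositional.Properties
  using (∈-filter⁺; ∈-filter⁻; ∈-map⁻; ∈-allFin; ∈-cartesianProductWith⁺)
open import Data.List.Properties using (filter-notAll; filter-≐; length-map; length-++)
open import Data.List.Relation.Binary.Subset.Propositional using (_⊆_)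
open import Data.List.Relation.Unary.All using (All; []; _∷_)
import Data.List.Relation.Unary.All as All
import Data.List.Relation.Unary.All.Properties as Allₚ
open import Data.List.Relation.Unary.AllPairs using ([]; _∷_)
open import Data.List.Relation.Unary.Any using (here; there)
import Data.List.Relation.Unary.Any as Any
open import Data.List.Relation.Unary.Unique.Propositional using (Unique)
import Data.List.Relation.Unary.Unique.Propositional.Properties as Uniqueₚ
open Uniqueₚ using (allFin⁺)
open import Data.Nat using (ℕ; _≤_; zero; suc; _+_; _<_; z≤n; s≤s; _<?_)
open import Data.Nat.Induction using (<-rec)
open import Data.Nat.Properties
  using (≤-trans; <-trans; ≤-<-trans; <-≤-trans; ≤-refl; <⇒≤; ≤-pred; ≤-antisym; <-irrefl; ≮⇒≥; anyUpTo?;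
         <-cmp; +-monoʳ-<; +-monoˡ-<; m≤n+m; +-comm; m<1+n⇒m<n∨m≡n; n<1+n; <⇒≢; ≡ᵇ⇒≡; ≡⇒≡ᵇ)
import Data.Nat.Properties as ℕₚ
open import Data.Product using (_×_; ∃; _,_; proj₁; proj₂)
open import Data.Sum using (_⊎_; inj₁; inj₂)
open import Data.Vec using (Vec; lookup; tabulate) renaming ([] to []ᵥ; _∷_ to _∷ᵥ_)
open import Data.Vec.Properties using (∷-injective; ≡-dec; lookup∘tabulate; tabulate∘lookup; tabulate-cong)
open import Function.Base using (_∘_; case_of_)
open import Function.Bundles using (_⇔_; mk⇔; Equivalence)
open import Function.Definitions using (Injective)
open import Relation.Binary using (DecidableEquality; tri<; tri≈; tri>)
open import Relation.Binary.PropositionalEquality using (_≡_; _≢_; _≗_; refl; sym; trans; cong; cong₂; subst)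
open Relation.Binary.PropositionalEquality.≡-Reasoning
open import Relation.Nullary using (¬_; Dec; yes; no; ¬?)
open import Relation.Nullary.Decidable using (_×-dec_)
open import Relation.Unary using (Decidable)

-- A duplicate-free list contained in ws is no longer than ws: removing its
-- head z from ws strictly shortens ws and keeps the tail contained.
length-≤-of-⊆ : {B : Set} → DecidableEquality B →
  (zs ws : List B) → Unique zs → zs ⊆ ws → length zs ≤ length ws
length-≤-of-⊆ _≟B_ []       ws _           _    = z≤n
length-≤-of-⊆ _≟B_ (z ∷ zs) ws (z∉zs ∷ uzs) z∷zs⊆ws =
  ≤-trans (s≤s (length-≤-of-⊆ _≟B_ zs ws-z uzs zs⊆ws-z)) ws-z<ws
  where
    ≢z? = λ w → ¬? (w ≟B z)
    ws-z = filter ≢z? ws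
    ws-z<ws : length ws-z < length ws
    ws-z<ws = filter-notAll ≢z? ws (Any.map (λ z≡w w≢z → w≢z (sym z≡w)) (z∷zs⊆ws (here refl)))
    zs⊆ws-z : zs ⊆ ws-z
    zs⊆ws-z y∈zs = ∈-filter⁺ ≢z? (z∷zs⊆ws (there y∈zs)) (λ y≡z → All.lookup z∉zs y∈zs (sym y≡z))

module _ {A B : Set} (_≟B_ : DecidableEquality B) {P : A → Set} {Q : B → Set}
         (P? : Decidable P) (Q? : Decidable Q) {xs : List A} {ys : List B}
         (f : A → B) (f-inj : Injective _≡_ _≡_ f) (uxs : Unique xs)
         (maps-to : ∀ {x} → x ∈ xs → P x → f x ∈ ys × Q (f x)) where

  private
    image = map f (filter P? xs)

    unique-image : Unique image
    unique-image = Uniqueₚ.map⁺ f-inj (Uniqueₚ.filter⁺ P? uxs)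

    image⊆ : image ⊆ filter Q? ys
    image⊆ y∈ with ∈-map⁻ f y∈
    ... | x , x∈ , refl = let x∈xs , px = ∈-filter⁻ P? x∈
                              fx∈ys , qfx = maps-to x∈xs px
                          in ∈-filter⁺ Q? fx∈ys qfx

  count-≤ : length (filter P? xs) ≤ length (filter Q? ys)
  count-≤ = subst (_≤ length (filter Q? ys)) (length-map f (filter P? xs))
    (length-≤-of-⊆ _≟B_ image (filter Q? ys) unique-image image⊆)

  count-< : (e : B) → e ∈ ys → Q e → (∀ {x} → x ∈ xs → P x → f x ≢ e) →
    length (filter P? xs) < length (filter Q? ys)
  count-< e e∈ys qe missed = subst (λ k → suc k ≤ length (filter Q? ys)) (length-map f (filter P? xs))
    (length-≤-of-⊆ _≟B_ (e ∷ image) (filter Q? ys) (e∉image ∷ unique-image) e∷image⊆)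
    where
      e∉image : All (e ≢_) image
      e∉image = All.tabulate λ y∈ e≡y → case ∈-map⁻ f y∈ of λ where
        (x , x∈ , y≡fx) → let x∈xs , px = ∈-filter⁻ P? x∈
                          in missed x∈xs px (sym (trans e≡y y≡fx))
      e∷image⊆ : (e ∷ image) ⊆ filter Q? ys
      e∷image⊆ (here refl) = ∈-filter⁺ Q? e∈ys qe
      e∷image⊆ (there y∈)  = image⊆ y∈

allVecs-suc : ∀ n q → allVecs (suc n) q ≡ cartesianProductWith _∷ᵥ_ (allFin q) (allVecs n q)
allVecs-suc n q = concatMap-as-product (allFin q)
  where
    concatMap-as-product : ∀ ks → concatMap (λ k → map (k ∷ᵥ_) (allVecs n q)) ks
                                    ≡ cartesianProductWith _∷ᵥ_ ks (allVecs n q)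
    concatMap-as-product []       = refl
    concatMap-as-product (k ∷ ks) = cong (map (k ∷ᵥ_) (allVecs n q) ++_) (concatMap-as-product ks)

∈-allVecs : ∀ n q (v : Vec (Fin q) n) → v ∈ allVecs n q
∈-allVecs zero    q []ᵥ      = here refl
∈-allVecs (suc n) q (k ∷ᵥ v) rewrite allVecs-suc n q =
  ∈-cartesianProductWith⁺ _∷ᵥ_ (∈-allFin k) (∈-allVecs n q v)

unique-allVecs : ∀ n q → Unique (allVecs n q)
unique-allVecs zero    q = [] ∷ []
unique-allVecs (suc n) q rewrite allVecs-suc n q =
  Uniqueₚ.cartesianProductWith⁺ _∷ᵥ_ ∷-injective (allFin⁺ q) (unique-allVecs n q)

2≰1 : ¬ (2 ≤ 1)
2≰1 (s≤s ())

module _ {m : ℕ} {P : Fin m → Set} (P? : Decidable P) where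

  count : ℕ
  count = length (filter P? (allFin m))

  private
    filtered-unique : Unique (filter P? (allFin m))
    filtered-unique = Uniqueₚ.filter⁺ P? (allFin⁺ m)

    ∈-filtered : ∀ {x} → P x → x ∈ filter P? (allFin m)
    ∈-filtered = ∈-filter⁺ P? (∈-allFin _)

  count≤1 : (x₀ : Fin m) → (∀ x → P x → x ≡ x₀) → count ≤ 1
  count≤1 x₀ only-x₀ = length-≤-of-⊆ _≟_ _ (x₀ ∷ []) filtered-unique
    (λ x∈ → here (only-x₀ _ (proj₂ (∈-filter⁻ P? {xs = allFin m} x∈))))

  count≥1 : ∀ x → P x → 1 ≤ count
  count≥1 x px = length-≤-of-⊆ _≟_ (x ∷ []) _ ([] ∷ []) λ { (here refl) → ∈-filtered px }

  count≥2 : ∀ x y → x ≢ y → P x → P y → 2 ≤ count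
  count≥2 x y x≢y px py = length-≤-of-⊆ _≟_ (x ∷ y ∷ []) _ ((x≢y ∷ []) ∷ [] ∷ [])
    λ { (here refl) → ∈-filtered px ; (there (here refl)) → ∈-filtered py }

  count≡1 : (x₀ : Fin m) → P x₀ → (∀ x → P x → x ≡ x₀) → count ≡ 1
  count≡1 x₀ px₀ only-x₀ = ≤-antisym (count≤1 x₀ only-x₀) (count≥1 x₀ px₀)

  count-witness : 1 ≤ count → ∃ P
  count-witness 1≤count with filter P? (allFin m) in eq | 1≤count
  ... | x ∷ _ | _ = x , proj₂ (∈-filter⁻ P? {xs = allFin m} (subst (x ∈_) (sym eq) (here refl)))

module _ {n q : ℕ} (G : Graph n) (c : Fin n → Fin q) (v : Fin n) where

  private
    coloured? : (k : Fin q) → Decidable (λ u → InClosedNbhd G v u × c u ≡ k)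
    coloured? k u = inClosedNbhd? G v u ×-dec (c u ≟ k)

    once? : Decidable (λ k → occ G c v k ≡ 1)
    once? k = occ G c v k ℕₚ.≟ 1

  UniqueIn : Fin n → Set
  UniqueIn u₀ = InClosedNbhd G v u₀ × (∀ u → InClosedNbhd G v u → c u ≡ c u₀ → u ≡ u₀)

  two-unique : ∀ {u₁ u₂} → UniqueIn u₁ → UniqueIn u₂ → c u₁ ≢ c u₂ → 2 ≤ uniqueColours G c v
  two-unique {u₁} {u₂} uniq₁ uniq₂ c₁≢c₂ =
    count≥2 once? (c u₁) (c u₂) c₁≢c₂ (occurs-once uniq₁) (occurs-once uniq₂)
    where
      occurs-once : ∀ {u₀} → UniqueIn u₀ → occ G c v (c u₀) ≡ 1
      occurs-once {u₀} (u₀∈ , only) = count≡1 (coloured? (c u₀)) u₀ (u₀∈ , refl) (λ u (u∈ , cu) → only u u∈ cu)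

  repeated-colour : ∀ {a b e} → InClosedNbhd G v a → InClosedNbhd G v b → a ≢ b → c a ≡ c b →
    (∀ u → InClosedNbhd G v u → u ≡ a ⊎ u ≡ b ⊎ u ≡ e) → uniqueColours G c v ≤ 1
  repeated-colour {a} {b} {e} a∈ b∈ a≢b ca≡cb N⊆abe = count≤1 once? (c e) only-ce
    where
      a-and-b : ∀ {k} → c a ≡ k → occ G c v k ≡ 1 → ⊥
      a-and-b {k} ca≡k once = 2≰1 (subst (2 ≤_) once
        (count≥2 (coloured? k) a b a≢b (a∈ , ca≡k) (b∈ , trans (sym ca≡cb) ca≡k)))
      only-ce : ∀ k → occ G c v k ≡ 1 → k ≡ c e
      only-ce k once with count-witness (coloured? k) (subst (1 ≤_) (sym once) ≤-refl)
      ... | u , u∈ , cu≡k with N⊆abe u u∈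
      ... | inj₁ refl         = ⊥-elim (a-and-b cu≡k once)
      ... | inj₂ (inj₁ refl)  = ⊥-elim (a-and-b (trans ca≡cb cu≡k) once)
      ... | inj₂ (inj₂ refl)  = sym cu≡k

Proper : ∀ {n q} → Graph n → (Fin n → Fin q) → Set
Proper G c = ∀ {x y} → adj G x y ≡ true → c x ≢ c y

Distinguished : ∀ {n q} → Graph n → (Fin n → Fin q) → Fin n → Fin n → Set
Distinguished G c v w = adj G v w ≡ true × (∀ u → adj G v u ≡ true → c u ≡ c w → u ≡ w)

-- In a properly coloured graph the colour of v is unique in N[v]; together
-- with a distinguished neighbour this gives v two unique colours.
scf-criterion : ∀ {n q} (G : Graph n) {c : Fin n → Fin q} → Proper G c →
  (∀ v → ∃ (Distinguished G c v)) → Is2SCF G c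
scf-criterion G {c} proper distinguished v with distinguished v
... | w , v~w , w-only = two-unique G c v v-unique w-unique (proper v~w)
  where
    v-unique : UniqueIn G c v v
    v-unique = inj₁ refl , λ where
      u (inj₁ u≡v) _   → u≡v
      u (inj₂ v~u) c≡ → ⊥-elim (proper v~u (sym c≡))
    w-unique : UniqueIn G c v w
    w-unique = inj₂ v~w , λ where
      u (inj₁ refl) c≡ → ⊥-elim (proper v~w c≡)
      u (inj₂ v~u)  c≡ → w-only u v~u c≡

-- The 2-scf property is invariant under graph isomorphism: if π maps H onto
-- G and c' = c ∘ π, then v has the same colour multiplicities in N_H[v] under
-- c' as π v has in N_G[π v] under c.
module _ {n q : ℕ} (G H : Graph n) (π : Permutation n n)
         (π-adj : ∀ i j → adj G (π ⟨$⟩ʳ i) (π ⟨$⟩ʳ j) ≡ adj H i j) where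

  private
    πʳ πˡ : Fin n → Fin n
    πʳ = π ⟨$⟩ʳ_
    πˡ = π ⟨$⟩ˡ_

    πʳ-injective : Injective _≡_ _≡_ πʳ
    πʳ-injective {x} {y} e = trans (sym (inverseˡ π)) (trans (cong πˡ e) (inverseˡ π))

    πˡ-injective : Injective _≡_ _≡_ πˡ
    πˡ-injective {x} {y} e = trans (sym (inverseʳ π)) (trans (cong πʳ e) (inverseʳ π))

    N-to : ∀ i j → InClosedNbhd H i j → InClosedNbhd G (πʳ i) (πʳ j)
    N-to i j (inj₁ j≡i) = inj₁ (cong πʳ j≡i)
    N-to i j (inj₂ i~j) = inj₂ (trans (π-adj i j) i~j)

    N-from : ∀ i u → InClosedNbhd G (πʳ i) u → InClosedNbhd H i (πˡ u)
    N-from i u (inj₁ u≡πi) = inj₁ (trans (cong πˡ u≡πi) (inverseˡ π))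
    N-from i u (inj₂ πi~u) =
      inj₂ (trans (sym (π-adj i (πˡ u))) (subst (λ z → adj G (πʳ i) z ≡ true) (sym (inverseʳ π)) πi~u))

  scf-transport : (c c' : Fin n → Fin q) → (∀ j → c' j ≡ c (πʳ j)) → Is2SCF G c → Is2SCF H c'
  scf-transport c c' c'≡cπ scf i = subst (2 ≤_) (sym unique-equal) (scf (πʳ i))
    where
      occ-equal : ∀ k → occ H c' i k ≡ occ G c (πʳ i) k
      occ-equal k = ≤-antisym
        (count-≤ _≟_ _ _ πʳ πʳ-injective (allFin⁺ n)
          (λ {j} _ (j∈ , c'j) → ∈-allFin _ , N-to i j j∈ , trans (sym (c'≡cπ j)) c'j))
        (count-≤ _≟_ _ _ πˡ πˡ-injective (allFin⁺ n)
          (λ {u} _ (u∈ , cu) → ∈-allFin _ , N-from i u u∈ , trans (c'≡cπ (πˡ u)) (trans (cong c (inverseʳ π)) cu)))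
      unique-equal : uniqueColours H c' i ≡ uniqueColours G c (πʳ i)
      unique-equal = cong length (filter-≐ (λ k → occ H c' i k ℕₚ.≟ 1) (λ k → occ G c (πʳ i) k ℕₚ.≟ 1)
        ((λ {k} p → trans (sym (occ-equal k)) p) , (λ {k} p → trans (occ-equal k) p)) (allFin q))

scf-cong : ∀ {n q} (G : Graph n) {c c' : Fin n → Fin q} → c ≗ c' → Is2SCF G c → Is2SCF G c'
scf-cong G {c} {c'} c≗c' = scf-transport G G Perm.id (λ _ _ → refl) c c' (λ j → sym (c≗c' j))

lookup-ext : ∀ {n} {A : Set} {v w : Vec A n} → lookup v ≗ lookup w → v ≡ w
lookup-ext {v = v} {w} v≗w = trans (sym (tabulate∘lookup v)) (trans (tabulate-cong v≗w) (tabulate∘lookup w))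

module _ {n q : ℕ} (G H : Graph n) (Φ : (Fin n → Fin q) → (Fin n → Fin q))
         (Φ-injective : ∀ {c c'} → Φ c ≗ Φ c' → c ≗ c')
         (Φ-scf : ∀ c → Is2SCF G c → Is2SCF H (Φ c)) where

  private
    F : Vec (Fin q) n → Vec (Fin q) n
    F v = tabulate (Φ (lookup v))

    lookup-F : ∀ {v w} → F v ≡ w → Φ (lookup v) ≗ lookup w
    lookup-F {v} refl i = sym (lookup∘tabulate (Φ (lookup v)) i)

    F-injective : Injective _≡_ _≡_ F
    F-injective {v} {w} Fv≡Fw = lookup-ext (Φ-injective {lookup v} {lookup w} λ i →
      trans (lookup-F {v} Fv≡Fw i) (sym (lookup-F {w} refl i)))

    scf? : (K : Graph n) → Decidable (λ (v : Vec (Fin q) n) → Is2SCF K (lookup v))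
    scf? K v = is2SCF? K (lookup v)

    maps-to : ∀ {v} → v ∈ allVecs n q → Is2SCF G (lookup v) →
      F v ∈ allVecs n q × Is2SCF H (lookup (F v))
    maps-to {v} _ scf = ∈-allVecs n q (F v) , scf-cong H (lookup-F {v} refl) (Φ-scf _ scf)

  χ-≤ : χ2scf G q ≤ χ2scf H q
  χ-≤ = count-≤ (≡-dec _≟_) (scf? G) (scf? H) {allVecs n q} {allVecs n q} F F-injective (unique-allVecs n q) maps-to

  χ-< : (e : Fin n → Fin q) → Is2SCF H e → (∀ c → Is2SCF G c → ¬ (Φ c ≗ e)) →
    χ2scf G q < χ2scf H q
  χ-< e e-scf e-missed =
    count-< (≡-dec _≟_) (scf? G) (scf? H) {allVecs n q} {allVecs n q} F F-injective (unique-allVecs n q) maps-to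
      (tabulate e) (∈-allVecs n q (tabulate e))
      (scf-cong H (λ i → sym (lookup∘tabulate e i)) e-scf)
      (λ {v} _ scf Fv≡e → e-missed (lookup v) scf λ i →
        trans (lookup-F {v} Fv≡e i) (lookup∘tabulate e i))

χ-≤-of-≅ : ∀ {n} q (G H : Graph n) → G ≅ H → χ2scf G q ≤ χ2scf H q
χ-≤-of-≅ {n} q G H (π , π-adj) = χ-≤ G H (λ c → c ∘ (π ⟨$⟩ʳ_)) reindex-injective
  (λ c → scf-transport G H π π-adj c (c ∘ (π ⟨$⟩ʳ_)) (λ _ → refl))
  where
    reindex-injective : ∀ {c c' : Fin n → Fin q} → c ∘ (π ⟨$⟩ʳ_) ≗ c' ∘ (π ⟨$⟩ʳ_) → c ≗ c'
    reindex-injective {c} {c'} e x =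
      trans (cong c (sym (inverseʳ π))) (trans (e (π ⟨$⟩ˡ x)) (cong c' (inverseʳ π)))

module _ {n : ℕ} (S : ℕ → Fin n) where

  Listed : ℕ → Fin n → Set
  Listed k x = ∃ λ m → m < k × S m ≡ x

  listed? : ∀ k → Decidable (Listed k)
  listed? k x = anyUpTo? (λ m → S m ≟ x) k

  InjectiveBelow : ℕ → Set
  InjectiveBelow k = ∀ {i j} → i < k → j < k → S i ≡ S j → i ≡ j

  unlisted⇒<n : ∀ k → InjectiveBelow k → ∀ w → ¬ Listed k w → k < n
  unlisted⇒<n k S-inj w w-new = injective⇒≤ {f = add-w} add-w-injective
    where
      add-w : Fin (suc k) → Fin n
      add-w i with toℕ i <? k
      ... | yes _ = S (toℕ i)
      ... | no _  = w

      ≡k : ∀ (i : Fin (suc k)) → ¬ toℕ i < k → toℕ i ≡ k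
      ≡k i i≮k = ≤-antisym (≤-pred (toℕ<n i)) (≮⇒≥ i≮k)

      add-w-injective : Injective _≡_ _≡_ add-w
      add-w-injective {i} {j} e with toℕ i <? k | toℕ j <? k
      ... | yes i<k | yes j<k = toℕ-injective (S-inj i<k j<k e)
      ... | yes i<k | no _    = ⊥-elim (w-new (toℕ i , i<k , e))
      ... | no _    | yes j<k = ⊥-elim (w-new (toℕ j , j<k , sym e))
      ... | no i≮k  | no j≮k  = toℕ-injective (trans (≡k i i≮k) (sym (≡k j j≮k)))

  all-listed⇒n≤ : ∀ k → (∀ x → Listed k x) → n ≤ k
  all-listed⇒n≤ k listed = injective⇒≤ {f = position} position-injective
    where
      position : Fin n → Fin k
      position x = fromℕ< (proj₁ (proj₂ (listed x)))

      position-injective : Injective _≡_ _≡_ position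
      position-injective {x} {y} e = trans (sym (proj₂ (proj₂ (listed x))))
        (trans (cong S (trans (sym (toℕ-fromℕ< _)) (trans (cong toℕ e) (toℕ-fromℕ< _))))
               (proj₂ (proj₂ (listed y))))

record Ordering {n : ℕ} (T : Graph n) (r : Fin n) (k : ℕ) : Set where
  field
    S           : ℕ → Fin n
    p           : ℕ → ℕ
    S-root      : S 0 ≡ r
    S-injective : InjectiveBelow S k
    p<          : ∀ {i} → 0 < i → i < k → p i < i
    parent-edge : ∀ {i} → 0 < i → i < k → adj T (S (p i)) (S i) ≡ true
    only-parent-edges : ∀ {i j} → i < k → j < k → adj T (S i) (S j) ≡ true →
      (0 < j × p j ≡ i) ⊎ (0 < i × p i ≡ j)

-- The path from S a to
-- S b repeatedly replaces the larger of the two indices by its parent until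
-- they meet; the recursion is bounded by the fuel f > a + b.
module TreePath {n k : ℕ} {T : Graph n} {r : Fin n} (O : Ordering T r k) where
  open Ordering O

  path : (f a b : ℕ) → List (Fin n)
  path zero    a b = []
  path (suc f) a b with <-cmp a b
  ... | tri< _ _ _ = path f a (p b) ++ S b ∷ []
  ... | tri≈ _ _ _ = S a ∷ []
  ... | tri> _ _ _ = S a ∷ path f (p a) b

  private
    positive : ∀ {a b} → a < b → 0 < b
    positive {b = suc b} _ = s≤s z≤n

    parent-of-larger : ∀ {a b} → a < b → b < k → p b < b
    parent-of-larger a<b b<k = p< (positive a<b) b<k

    fuel-right : ∀ {a b b' f} → b' < b → a + b < suc f → a + b' < f
    fuel-right {a} b'<b h = ≤-trans (+-monoʳ-< a b'<b) (≤-pred h)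

    fuel-left : ∀ {a a' b f} → a' < a → a + b < suc f → a' + b < f
    fuel-left {b = b} a'<a h = ≤-trans (+-monoˡ-< b a'<a) (≤-pred h)

    closed-snoc : ∀ x L y t → ClosedFrom T x L y → adj T y t ≡ true → ClosedFrom T x (L ++ y ∷ []) t
    closed-snoc x []      y t x~y y~t = x~y , y~t
    closed-snoc x (z ∷ L) y t (x~z , rest) y~t = x~z , closed-snoc z L y t rest y~t

    fresh : ∀ {a} → a < k → ¬ Listed S a (S a)
    fresh a<k (m , m<a , Sm≡Sa) = <-irrefl (S-injective (<-trans m<a a<k) a<k Sm≡Sa) m<a

  path-closed : ∀ f a b → a + b < f → a < k → b < k → ∀ x t →
    adj T x (S a) ≡ true → adj T (S b) t ≡ true → ClosedFrom T x (path f a b) t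
  path-closed (suc f) a b h a<k b<k x t x~a b~t with <-cmp a b
  ... | tri< a<b _ _ = closed-snoc x (path f a (p b)) (S b) t
        (path-closed f a (p b) (fuel-right pb<b h) a<k (<-trans pb<b b<k) x (S b) x~a
          (parent-edge (positive a<b) b<k)) b~t
    where pb<b = parent-of-larger a<b b<k
  ... | tri≈ _ refl _ = x~a , b~t
  ... | tri> _ _ b<a = x~a , path-closed f (p a) b (fuel-left pa<a h) (<-trans pa<a a<k) b<k (S a) t
        (trans (adj-sym T (S a) (S (p a))) (parent-edge (positive b<a) a<k)) b~t
    where pa<a = parent-of-larger b<a a<k

  path-listed : ∀ f a b M → a + b < f → a < k → b < k → a < M → b < M →
    All (Listed S M) (path f a b)
  path-listed (suc f) a b M h a<k b<k a<M b<M with <-cmp a b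
  ... | tri< a<b _ _ = Allₚ.++⁺ (path-listed f a (p b) M (fuel-right pb<b h) a<k (<-trans pb<b b<k) a<M
          (<-trans pb<b b<M)) ((b , b<M , refl) ∷ [])
    where pb<b = parent-of-larger a<b b<k
  ... | tri≈ _ refl _ = (a , a<M , refl) ∷ []
  ... | tri> _ _ b<a = (a , a<M , refl) ∷ path-listed f (p a) b M (fuel-left pa<a h) (<-trans pa<a a<k)
          b<k (<-trans pa<a a<M) b<M
    where pa<a = parent-of-larger b<a a<k

  path-unique : ∀ f a b → a + b < f → a < k → b < k → Unique (path f a b)
  path-unique (suc f) a b h a<k b<k with <-cmp a b
  ... | tri< a<b _ _ = Uniqueₚ.++⁺ (path-unique f a (p b) (fuel-right pb<b h) a<k (<-trans pb<b b<k))
          ([] ∷ []) S-b-not-before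
    where
      pb<b = parent-of-larger a<b b<k
      S-b-not-before : ∀ {y} → ¬ (y ∈ path f a (p b) × y ∈ S b ∷ [])
      S-b-not-before (y∈ , here refl) = fresh b<k (All.lookup
        (path-listed f a (p b) b (fuel-right pb<b h) a<k (<-trans pb<b b<k) a<b pb<b) y∈)
  ... | tri≈ _ refl _ = [] ∷ []
  ... | tri> _ _ b<a = All.map (λ listed S-a≡y → fresh a<k (subst (Listed S a) (sym S-a≡y) listed))
          (path-listed f (p a) b a (fuel-left pa<a h) (<-trans pa<a a<k) b<k pa<a b<a)
        ∷ path-unique f (p a) b (fuel-left pa<a h) (<-trans pa<a a<k) b<k
    where pa<a = parent-of-larger b<a a<k

  path-nonempty : ∀ f a b → a + b < f → 1 ≤ length (path f a b)
  path-nonempty (suc f) a b h with <-cmp a b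
  ... | tri< _ _ _ = subst (1 ≤_) (sym (length-++ (path f a (p b)))) (m≤n+m 1 _)
  ... | tri≈ _ _ _ = s≤s z≤n
  ... | tri> _ _ _ = s≤s z≤n

  path-long : ∀ f a b → a + b < f → a < k → b < k → a ≢ b → 2 ≤ length (path f a b)
  path-long (suc f) a b h a<k b<k a≢b with <-cmp a b
  ... | tri< a<b _ _ = subst (2 ≤_) (sym (length-++ (path f a (p b))))
        (subst (2 ≤_) (+-comm 1 _) (s≤s (path-nonempty f a (p b) (fuel-right (parent-of-larger a<b b<k) h))))
  ... | tri≈ _ a≡b _ = ⊥-elim (a≢b a≡b)
  ... | tri> _ _ b<a = s≤s (path-nonempty f (p a) b (fuel-left (parent-of-larger b<a a<k) h))

  cycle : ∀ v → ¬ Listed S k v → ∀ {a b} → a < k → b < k → a ≢ b →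
    adj T v (S a) ≡ true → adj T v (S b) ≡ true → Cycle T
  cycle v v-new {a} {b} a<k b<k a≢b v~a v~b = record
    { start  = v
    ; rest   = path f a b
    ; unique = All.map (λ listed v≡y → v-new (subst (Listed S k) (sym v≡y) listed))
                 (path-listed f a b k h a<k b<k a<k b<k)
               ∷ path-unique f a b h a<k b<k
    ; long   = path-long f a b h a<k b<k a≢b
    ; closed = path-closed f a b h a<k b<k v v v~a (trans (adj-sym T (S b) v) v~b)
    }
    where
      f = suc (a + b)
      h : a + b < f
      h = ≤-refl

_[_≔_] : {A : Set} → (ℕ → A) → ℕ → A → ℕ → A
(f [ k ≔ a ]) x with x ℕₚ.≟ k
... | yes _ = a
... | no _  = f x

≔-new : {A : Set} (f : ℕ → A) (k : ℕ) (a : A) → (f [ k ≔ a ]) k ≡ a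
≔-new f k a with k ℕₚ.≟ k
... | yes _  = refl
... | no k≢k = ⊥-elim (k≢k refl)

≔-old : {A : Set} (f : ℕ → A) (k : ℕ) (a : A) {x : ℕ} → x < k → (f [ k ≔ a ]) x ≡ f x
≔-old f k a {x} x<k with x ℕₚ.≟ k
... | yes refl = ⊥-elim (<-irrefl refl x<k)
... | no _     = refl

-- Every tree has a parent ordering of all of its vertices from any root:
-- starting from the root alone, connectivity provides an edge from a listed
-- vertex u to an unlisted one v, and acyclicity makes u the only listed
-- neighbour of v, so v can be appended with parent u.
module Grow {n : ℕ} (T : Graph n) (tree : IsTree T) (r : Fin n) where

  private
    true≢false : true ≢ false
    true≢false ()

  crossing-edge : ∀ (S : ℕ → Fin n) k {a w} → Walk T a w → Listed S k a → ¬ Listed S k w →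
    ∃ λ u → ∃ λ v → Listed S k u × ¬ Listed S k v × adj T u v ≡ true
  crossing-edge S k here a-in w-out = ⊥-elim (w-out a-in)
  crossing-edge S k {a} (step {w = x} a~x walk) a-in w-out with listed? S k x
  ... | yes x-in = crossing-edge S k walk x-in w-out
  ... | no x-out = a , x , a-in , x-out , a~x

  start : Ordering T r 1
  start = record
    { S = λ _ → r ; p = λ _ → 0 ; S-root = refl
    ; S-injective = λ { (s≤s z≤n) (s≤s z≤n) _ → refl }
    ; p< = λ { (s≤s z≤n) (s≤s ()) }
    ; parent-edge = λ { (s≤s z≤n) (s≤s ()) }
    ; only-parent-edges = λ { (s≤s z≤n) (s≤s z≤n) r~r → ⊥-elim (true≢false (trans (sym r~r) (adj-irr T r))) }
    }

  next-vertex : ∀ {k} (O : Ordering T r k) → 0 < k → k < n →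
    ∃ λ i₀ → ∃ λ v → i₀ < k × ¬ Listed (Ordering.S O) k v × adj T (Ordering.S O i₀) v ≡ true
  next-vertex {k} O 0<k k<n =
    let u , v , (i₀ , i₀<k , Si₀≡u) , v-new , u~v = crossing-edge S k (proj₁ tree r w) (0 , 0<k , S-root) w-new
    in  i₀ , v , i₀<k , v-new , subst (λ z → adj T z v ≡ true) (sym Si₀≡u) u~v
    where
      open Ordering O

      unlisted : ∃ λ w → ¬ Listed S k w
      unlisted with any? (λ x → ¬? (listed? S k x))
      ... | yes w-new = w-new
      ... | no none   = ⊥-elim (<-irrefl refl (<-≤-trans k<n (all-listed⇒n≤ S k every-listed)))
        where
          every-listed : ∀ x → Listed S k x
          every-listed x with listed? S k x
          ... | yes x-in = x-in
          ... | no x-out = ⊥-elim (none (x , x-out))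

      w = proj₁ unlisted
      w-new = proj₂ unlisted

  extend : ∀ {k} → Ordering T r k → 0 < k → k < n → Ordering T r (suc k)
  extend {k} O 0<k k<n with next-vertex O 0<k k<n
  ... | i₀ , v , i₀<k , v-new , i₀~v = record
    { S = S' ; p = p' ; S-root = trans (≔-old S k v 0<k) S-root
    ; S-injective = S'-injective ; p< = p'< ; parent-edge = parent-edge' ; only-parent-edges = only' }
    where
      open Ordering O
      open TreePath O using (cycle)

      S' = S [ k ≔ v ]
      p' = p [ k ≔ i₀ ]

      split : ∀ {i} → i < suc k → i < k ⊎ i ≡ k
      split = m<1+n⇒m<n∨m≡n

      S'-injective : InjectiveBelow S' (suc k)
      S'-injective {i} {j} hi hj e with split hi | split hj
      ... | inj₁ i<k  | inj₁ j<k  = S-injective i<k j<k (trans (sym (≔-old S k v i<k)) (trans e (≔-old S k v j<k)))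
      ... | inj₁ i<k  | inj₂ refl = ⊥-elim (v-new (i , i<k , trans (sym (≔-old S k v i<k)) (trans e (≔-new S k v))))
      ... | inj₂ refl | inj₁ j<k  = ⊥-elim (v-new (j , j<k , trans (sym (≔-old S k v j<k)) (trans (sym e) (≔-new S k v))))
      ... | inj₂ refl | inj₂ refl = refl

      p'< : ∀ {i} → 0 < i → i < suc k → p' i < i
      p'< {i} 0<i hi with split hi
      ... | inj₁ i<k  = subst (_< i) (sym (≔-old p k i₀ i<k)) (p< 0<i i<k)
      ... | inj₂ refl = subst (_< k) (sym (≔-new p k i₀)) i₀<k

      parent-edge' : ∀ {i} → 0 < i → i < suc k → adj T (S' (p' i)) (S' i) ≡ true
      parent-edge' {i} 0<i hi with split hi
      ... | inj₁ i<k rewrite ≔-old p k i₀ i<k | ≔-old S k v i<k | ≔-old S k v (<-trans (p< 0<i i<k) i<k) =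
            parent-edge 0<i i<k
      ... | inj₂ refl rewrite ≔-new p k i₀ | ≔-new S k v | ≔-old S k v i₀<k = i₀~v

      -- acyclicity: S i₀ is the only listed neighbour of v
      only-neighbour : ∀ {j} → j < k → adj T v (S j) ≡ true → i₀ ≡ j
      only-neighbour {j} j<k v~j with i₀ ℕₚ.≟ j
      ... | yes i₀≡j = i₀≡j
      ... | no i₀≢j  = ⊥-elim (proj₂ tree (cycle v v-new i₀<k j<k i₀≢j (trans (adj-sym T v (S i₀)) i₀~v) v~j))

      only' : ∀ {i j} → i < suc k → j < suc k → adj T (S' i) (S' j) ≡ true →
        (0 < j × p' j ≡ i) ⊎ (0 < i × p' i ≡ j)
      only' {i} {j} hi hj e with split hi | split hj
      ... | inj₁ i<k  | inj₁ j<k rewrite ≔-old S k v i<k | ≔-old S k v j<k | ≔-old p k i₀ i<k | ≔-old p k i₀ j<k =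
            only-parent-edges i<k j<k e
      ... | inj₂ refl | inj₁ j<k rewrite ≔-new S k v | ≔-old S k v j<k | ≔-new p k i₀ =
            inj₂ (0<k , only-neighbour j<k e)
      ... | inj₁ i<k  | inj₂ refl rewrite ≔-new S k v | ≔-old S k v i<k | ≔-new p k i₀ =
            inj₁ (0<k , only-neighbour i<k (trans (adj-sym T v (S i)) e))
      ... | inj₂ refl | inj₂ refl rewrite ≔-new S k v = ⊥-elim (true≢false (trans (sym e) (adj-irr T v)))

  ordering : ∀ k → 0 < k → k ≤ n → Ordering T r k
  ordering (suc zero)    _ _   = start
  ordering (suc (suc k)) _ k<n = extend (ordering (suc k) (s≤s z≤n) (<⇒≤ k<n)) (s≤s z≤n) k<n

record Rooted {n : ℕ} (T : Graph n) (r : Fin n) : Set where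
  field
    ordering : Ordering T r n
  open Ordering ordering public
  field
    index   : Fin n → ℕ
    index<n : ∀ x → index x < n
    S-index : ∀ x → S (index x) ≡ x

  index-S : ∀ {j} → j < n → index (S j) ≡ j
  index-S {j} j<n = S-injective (index<n (S j)) j<n (S-index (S j))

  neighbour-cases : ∀ {m u} → m < n → adj T (S m) u ≡ true →
    (0 < index u × p (index u) ≡ m) ⊎ (0 < m × u ≡ S (p m))
  neighbour-cases {m} {u} m<n m~u
    with only-parent-edges m<n (index<n u) (subst (λ z → adj T (S m) z ≡ true) (sym (S-index u)) m~u)
  ... | inj₁ child        = inj₁ child
  ... | inj₂ (0<m , pm≡u) = inj₂ (0<m , trans (sym (S-index u)) (cong S (sym pm≡u)))

-- Every tree has a rooted ordering from any root: a parent ordering of all n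
-- vertices lists every vertex, by the pigeonhole principle.
abstract
  rooted : ∀ {n} (T : Graph n) → IsTree T → (r : Fin n) → Rooted T r
  rooted {n} T tree r = record
    { ordering = O
    ; index    = λ x → proj₁ (listed x)
    ; index<n  = λ x → proj₁ (proj₂ (listed x))
    ; S-index  = λ x → proj₂ (proj₂ (listed x))
    }
    where
      O : Ordering T r n
      O = Grow.ordering T tree r n (≤-<-trans z≤n (toℕ<n r)) ≤-refl
      open Ordering O
      listed : ∀ x → Listed S n x
      listed x with listed? S n x
      ... | yes x-in = x-in
      ... | no x-out = ⊥-elim (<-irrefl refl (unlisted⇒<n S n S-injective x x-out))

module _ {q : ℕ} where

  transpose-source : (i j : Fin q) → transpose i j i ≡ j
  transpose-source i j with i ≟ i
  ... | yes _  = refl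
  ... | no i≢i = ⊥-elim (i≢i refl)

  transpose-fixed : ∀ (i j k : Fin q) → k ≢ i → k ≢ j → transpose i j k ≡ k
  transpose-fixed i j k k≢i k≢j with k ≟ i
  ... | yes k≡i = ⊥-elim (k≢i k≡i)
  ... | no _ with k ≟ j
  ...   | yes k≡j = ⊥-elim (k≢j k≡j)
  ...   | no _    = refl

  transpose-injective : (i j : Fin q) → Injective _≡_ _≡_ (transpose i j)
  transpose-injective i j {k} {k'} e =
    trans (sym (transpose-inverse j i)) (trans (cong (transpose j i) e) (transpose-inverse j i))

  retarget : (x y x' y' : Fin q) → Fin q → Fin q
  retarget x y x' y' = transpose (transpose x x' y) y' ∘ transpose x x'

  retarget-injective : ∀ x y x' y' → Injective _≡_ _≡_ (retarget x y x' y')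
  retarget-injective x y x' y' e = transpose-injective x x' (transpose-injective (transpose x x' y) y' e)

  retarget-y : ∀ x y x' y' → retarget x y x' y' y ≡ y'
  retarget-y x y x' y' = transpose-source (transpose x x' y) y'

  retarget-x : ∀ x y x' y' → x ≢ y → x' ≢ y' → retarget x y x' y' x ≡ x'
  retarget-x x y x' y' x≢y x'≢y' rewrite transpose-source x x' =
    transpose-fixed (transpose x x' y) y' x'
      (λ x'≡ → x≢y (transpose-injective x x' (trans (transpose-source x x') x'≡))) x'≢y'

-- Course-of-values recursion: the sequence whose i-th term (i < n) is
-- computed by rule i from the earlier terms.  It is obtained by iterating
-- rule with a fuel bound; locality of rule makes the result independent
-- of the fuel.
module CourseOfValues {A : Set} (n : ℕ) (default : A) (rule : ℕ → (ℕ → A) → A)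
  (rule-local : ∀ {i} (g h : ℕ → A) → i < n → (∀ {j} → j < i → g j ≡ h j) → rule i g ≡ rule i h) where

  private
    approx : ℕ → ℕ → A
    approx zero    _ = default
    approx (suc f) i = rule i (approx f)

    approx-stable : ∀ f g i → i < f → i < g → i < n → approx f i ≡ approx g i
    approx-stable (suc f) (suc g) i i<f i<g i<n = rule-local (approx f) (approx g) i<n λ {j} j<i →
      approx-stable f g j (<-≤-trans j<i (≤-pred i<f)) (<-≤-trans j<i (≤-pred i<g)) (<-trans j<i i<n)

  seq : ℕ → A
  seq i = approx (suc i) i

  unfold : ∀ {i} → i < n → seq i ≡ rule i seq
  unfold {i} i<n = rule-local (approx i) seq i<n λ {j} j<i →
    approx-stable i (suc j) j j<i ≤-refl (<-trans j<i i<n)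

-- The vertex at position i of a path on suc m vertices (clamped at the end).
at : ∀ {m} → ℕ → Fin (suc m)
at         zero    = Fin.zero
at {zero}  (suc i) = Fin.zero
at {suc m} (suc i) = Fin.suc (at i)

toℕ-at : ∀ {m} i → i < suc m → toℕ (at {m} i) ≡ i
toℕ-at         zero    _         = refl
toℕ-at {zero}  (suc i) (s≤s ())
toℕ-at {suc m} (suc i) (s≤s i<m) = cong suc (toℕ-at i i<m)

at-toℕ : ∀ {m} (x : Fin (suc m)) → at (toℕ x) ≡ x
at-toℕ x = toℕ-injective (toℕ-at (toℕ x) (toℕ<n x))

P-adj⁻ : ∀ {n} {v u : Fin n} → adj (P n) v u ≡ true →
  suc (toℕ v) ≡ toℕ u ⊎ suc (toℕ u) ≡ toℕ v
P-adj⁻ {v = v} {u} v~u with Equivalence.to T-∨ (Equivalence.from T-≡ v~u)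
... | inj₁ t = inj₁ (≡ᵇ⇒≡ (suc (toℕ v)) (toℕ u) t)
... | inj₂ t = inj₂ (≡ᵇ⇒≡ (suc (toℕ u)) (toℕ v) t)

P-adj⁺ : ∀ {n} {v u : Fin n} → suc (toℕ v) ≡ toℕ u → adj (P n) v u ≡ true
P-adj⁺ {v = v} {u} e = Equivalence.to T-≡ (Equivalence.from T-∨ (inj₁ (≡⇒≡ᵇ (suc (toℕ v)) (toℕ u) e)))

record Spread {q : ℕ} (n : ℕ) (C : ℕ → Fin q) : Set where
  field
    differ₁ : ∀ i → suc i < n → C (suc i) ≢ C i
    differ₂ : ∀ i → suc (suc i) < n → C (suc (suc i)) ≢ C i

-- In a 2-scf colouring of a path any three consecutive vertices have distinct
-- colours: N[at (i+1)] ⊆ {at i, at (i+1), at (i+2)}, and a repeated colour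
-- among them leaves at most one unique colour.
path-spread : ∀ {m q} (c : Fin (suc m) → Fin q) → Is2SCF (P (suc m)) c → Spread (suc m) (c ∘ at)
path-spread {m} c scf = record { differ₁ = differ₁ ; differ₂ = differ₂ }
  where
    n = suc m

    at-injective : ∀ {i j} → i < n → j < n → at {m} i ≡ at j → i ≡ j
    at-injective {i} {j} i<n j<n e = trans (sym (toℕ-at i i<n)) (trans (cong toℕ e) (toℕ-at j j<n))

    left : ∀ i → suc i < n → InClosedNbhd (P n) (at (suc i)) (at i)
    left i h = inj₂ (trans (adj-sym (P n) (at (suc i)) (at i))
      (P-adj⁺ (trans (cong suc (toℕ-at i (<-trans (n<1+n i) h))) (sym (toℕ-at (suc i) h)))))

    right : ∀ i → suc (suc i) < n → InClosedNbhd (P n) (at (suc i)) (at (suc (suc i)))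
    right i h = inj₂ (P-adj⁺ (trans (cong suc (toℕ-at (suc i) (<-trans (n<1+n (suc i)) h))) (sym (toℕ-at (suc (suc i)) h))))

    nbhd : ∀ i → suc i < n → ∀ u → InClosedNbhd (P n) (at (suc i)) u →
      u ≡ at (suc i) ⊎ u ≡ at i ⊎ u ≡ at (suc (suc i))
    nbhd i h u (inj₁ u≡v) = inj₁ u≡v
    nbhd i h u (inj₂ v~u) with P-adj⁻ v~u
    ... | inj₁ e = inj₂ (inj₂ (trans (sym (at-toℕ u)) (cong at (trans (sym e) (cong suc (toℕ-at (suc i) h))))))
    ... | inj₂ e = inj₂ (inj₁ (trans (sym (at-toℕ u)) (cong at (ℕₚ.suc-injective (trans e (toℕ-at (suc i) h))))))

    differ₁ : ∀ i → suc i < n → c (at (suc i)) ≢ c (at i)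
    differ₁ i h same = 2≰1 (≤-trans (scf (at (suc i)))
      (repeated-colour (P n) c (at (suc i)) (inj₁ refl) (left i h)
        (λ e → <⇒≢ (n<1+n i) (sym (at-injective h (<-trans (n<1+n i) h) e))) same (nbhd i h)))

    differ₂ : ∀ i → suc (suc i) < n → c (at (suc (suc i))) ≢ c (at i)
    differ₂ i h same = 2≰1 (≤-trans (scf (at (suc i)))
      (repeated-colour (P n) c (at (suc i)) (right i h) (left i h')
        (λ e → <⇒≢ (<-trans (n<1+n i) (n<1+n (suc i))) (sym (at-injective h (<-trans (n<1+n i) h') e))) same
        (λ u u∈ → rotate (nbhd i h' u u∈))))
      where
        h' = <-trans (n<1+n (suc i)) h
        rotate : ∀ {A : Set} {a b e : A} {u} → u ≡ e ⊎ u ≡ b ⊎ u ≡ a → u ≡ a ⊎ u ≡ b ⊎ u ≡ e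
        rotate (inj₁ x)        = inj₂ (inj₂ x)
        rotate (inj₂ (inj₁ x)) = inj₂ (inj₁ x)
        rotate (inj₂ (inj₂ x)) = inj₁ x

-- Colourings of a rooted tree given by a sequence d of colours of the
-- positions 0, …, n-1 (the vertex S i gets d i).
module RootedColouring {n q : ℕ} {T : Graph n} {r : Fin n} (R : Rooted T r) (1<n : 1 < n) where
  open Rooted R

  -- The partner of m is its parent, or vertex 1 when m is the root; S m and
  -- S (partner m) will be the two vertices of unique colour in N[S m].
  partner : ℕ → ℕ
  partner zero    = 1
  partner (suc m) = p (suc m)

  partner-pos : ∀ {m} → 0 < m → partner m ≡ p m
  partner-pos {suc m} _ = refl

  p1≡0 : p 1 ≡ 0
  p1≡0 with p 1 | p< (s≤s z≤n) 1<n
  ... | zero  | _      = refl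
  ... | suc _ | s≤s ()

  partner< : ∀ {m i} → m < i → i < n → 2 ≤ i → partner m < i
  partner< {zero}  _   _   2≤i = 2≤i
  partner< {suc m} m<i i<n _   = <-trans (p< (s≤s z≤n) (<-trans m<i i<n)) m<i

  partner<n : ∀ {m} → m < n → partner m < n
  partner<n {zero}  _   = 1<n
  partner<n {suc m} m<n = <-trans (p< (s≤s z≤n) m<n) m<n

  child≥2 : ∀ {j m} → 0 < j → p j ≡ m → j ≢ partner m → 2 ≤ j
  child≥2 {suc zero}    _ pj≡m j≢ = ⊥-elim (j≢ (cong partner (trans (sym p1≡0) pj≡m)))
  child≥2 {suc (suc j)} _ _    _  = s≤s (s≤s z≤n)

  -- Colours differing along parent edges give a proper colouring, since
  -- every edge of T is a parent edge.
  proper-from-parents : (d : ℕ → Fin q) → (∀ {i} → 0 < i → i < n → d i ≢ d (p i)) →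
    Proper T (d ∘ index)
  proper-from-parents d parent-differs {x} {y} x~y
    with neighbour-cases (index<n x) (subst (λ z → adj T z y ≡ true) (sym (S-index x)) x~y)
  ... | inj₁ (0<j , pj≡i) = λ same → parent-differs 0<j (index<n y) (trans (sym same) (cong d (sym pj≡i)))
  ... | inj₂ (0<i , y≡S) = λ same →
        parent-differs 0<i (index<n x) (trans same (cong d (trans (cong index y≡S) (index-S pi<n))))
    where pi<n = <-trans (p< 0<i (index<n x)) (index<n x)

  partner-distinguished : ∀ (d : ℕ → Fin q) {m} → m < n →
    (∀ {j} → 0 < j → j < n → p j ≡ m → j ≢ partner m → d j ≢ d (partner m)) →
    Distinguished T (d ∘ index) (S m) (S (partner m))
  partner-distinguished d {m} m<n children-differ = m~partner m<n , only-partner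
    where
      m~partner : ∀ {m} → m < n → adj T (S m) (S (partner m)) ≡ true
      m~partner {zero}  _   = subst (λ z → adj T (S z) (S 1) ≡ true) p1≡0 (parent-edge (s≤s z≤n) 1<n)
      m~partner {suc m} m<n = trans (adj-sym T _ _) (parent-edge (s≤s z≤n) m<n)

      only-partner : ∀ u → adj T (S m) u ≡ true → d (index u) ≡ d (index (S (partner m))) → u ≡ S (partner m)
      only-partner u m~u same with neighbour-cases m<n m~u
      ... | inj₂ (0<m , u≡S) = trans u≡S (cong S (sym (partner-pos 0<m)))
      ... | inj₁ (0<j , pj≡m) with index u ℕₚ.≟ partner m
      ...   | yes j≡ = trans (sym (S-index u)) (cong S j≡)
      ...   | no j≢  = ⊥-elim (children-differ 0<j (index<n u) pj≡m j≢
                         (trans same (cong d (index-S (partner<n m<n)))))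

  scf-by-positions : (d : ℕ → Fin q) → (∀ {i} → 0 < i → i < n → d i ≢ d (p i)) →
    (∀ {m} → m < n → ∃ (Distinguished T (d ∘ index) (S m))) → Is2SCF T (d ∘ index)
  scf-by-positions d parent-differs distinguished = scf-criterion T (proper-from-parents d parent-differs)
    λ x → subst (λ v → ∃ (Distinguished T (d ∘ index) v)) (S-index x) (distinguished (index<n x))

  module Transport (C : ℕ → Fin q) where

    rule : ℕ → (ℕ → Fin q) → Fin q
    rule zero             _ = C 0
    rule (suc zero)       _ = C 1
    rule i@(suc (suc j))  g = retarget (C (suc j)) (C j) (g (p i)) (g (partner (p i))) (C i)

    private
      rule-local : ∀ {i} (g h : ℕ → Fin q) → i < n → (∀ {j} → j < i → g j ≡ h j) → rule i g ≡ rule i h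
      rule-local {zero}        _ _ _   _     = refl
      rule-local {suc zero}    _ _ _   _     = refl
      rule-local {suc (suc j)} g h i<n agree = cong₂ (λ a b → retarget (C (suc j)) (C j) a b (C (suc (suc j))))
        (agree pi<i) (agree (partner< pi<i i<n (s≤s (s≤s z≤n))))
        where pi<i = p< (s≤s z≤n) i<n

    open CourseOfValues n (C 0) rule rule-local public renaming (seq to D)

    module _ (spread : Spread n C) where
      open Spread spread

      -- By induction D (p i) ≢ D (partner (p i)) (the claim at p i, or at 1
      -- when p i is the root), so the permutation defining D i sends C (i-1)
      -- to D (p i); and C i ≢ C (i-1).
      D-parent : ∀ {i} → 0 < i → i < n → D i ≢ D (p i)
      D-parent {i} = <-rec (λ i → 0 < i → i < n → D i ≢ D (p i)) differs i
        where
          differs : ∀ i → (∀ {k} → k < i → 0 < k → k < n → D k ≢ D (p k)) → 0 < i → i < n → D i ≢ D (p i)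
          differs (suc zero) _ _ _ D1≡Dp1 =
            differ₁ 0 1<n (trans (sym (unfold 1<n)) (trans D1≡Dp1 (trans (cong D p1≡0) (unfold (<-trans (s≤s z≤n) 1<n)))))
          differs i@(suc (suc j)) ih _ i<n Di≡Dpi = differ₁ (suc j) i<n (retarget-injective x y x' y'
              (trans (sym (unfold i<n)) (trans Di≡Dpi (sym (retarget-x x y x' y' (differ₁ j j+1<n) (partner-differs pi<i))))))
            where
              x = C (suc j) ; y = C j ; x' = D (p i) ; y' = D (partner (p i))
              j+1<n = <-trans (n<1+n (suc j)) i<n
              pi<i = p< (s≤s z≤n) i<n
              partner-differs : ∀ {m} → m < i → D m ≢ D (partner m)
              partner-differs {zero}  _   D0≡D1 = ih (s≤s (s≤s z≤n)) (s≤s z≤n) 1<n (trans (sym D0≡D1) (cong D (sym p1≡0)))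
              partner-differs {suc m} m<i = ih m<i (s≤s z≤n) (<-trans m<i i<n)

      -- The permutation defining D i sends C (i-2) to D (partner (p i)), and C i ≢ C (i-2).
      D-partner : ∀ {i} → 2 ≤ i → i < n → D i ≢ D (partner (p i))
      D-partner {suc zero} (s≤s ())
      D-partner {suc (suc j)} _ i<n Di≡ = differ₂ j i<n (retarget-injective x y x' y'
          (trans (sym (unfold i<n)) (trans Di≡ (sym (retarget-y x y x' y')))))
        where x = C (suc j) ; y = C j ; x' = D (p (suc (suc j))) ; y' = D (partner (p (suc (suc j))))

      -- S (partner m) is distinguished at every S m, since the other children j
      -- of m satisfy D j ≢ D (partner (p j)) = D (partner m).
      transported-scf : Is2SCF T (D ∘ index)
      transported-scf = scf-by-positions D D-parent λ m<n → _ , partner-distinguished D m<n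
        λ 0<j j<n pj≡m j≢ same → D-partner (child≥2 0<j pj≡m j≢) j<n (trans same (cong (D ∘ partner) (sym pj≡m)))

  -- The transport is injective: D determines C position by position.
  transport-injective : ∀ {C C'} → (∀ {i} → i < n → Transport.D C i ≡ Transport.D C' i) →
    ∀ {i} → i < n → C i ≡ C' i
  transport-injective {C} {C'} agree {i} = <-rec (λ i → i < n → C i ≡ C' i) same i
    where
      open Transport using (D; unfold)
      same : ∀ i → (∀ {k} → k < i → k < n → C k ≡ C' k) → i < n → C i ≡ C' i
      same zero          _  i<n = trans (sym (unfold C i<n)) (trans (agree i<n) (unfold C' i<n))
      same (suc zero)    _  i<n = trans (sym (unfold C i<n)) (trans (agree i<n) (unfold C' i<n))
      same i@(suc (suc j)) ih i<n = retarget-injective x y x' y' (begin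
          retarget x y x' y' (C i)                   ≡⟨ sym (unfold C i<n) ⟩
          D C i                                      ≡⟨ agree i<n ⟩
          D C' i                                     ≡⟨ unfold C' i<n ⟩
          retarget (C' (suc j)) (C' j) (D C' (p i)) (D C' (partner (p i))) (C' i)
            ≡⟨ cong-retarget {z = C' i} (sym (ih (n<1+n (suc j)) j+1<n)) (sym (ih j<i (<-trans j<i i<n)))
                             (sym (agree pi<n)) (sym (agree (<-trans partner<i i<n))) ⟩
          retarget x y x' y' (C' i)                  ∎)
        where
          x = C (suc j) ; y = C j ; x' = D C (p i) ; y' = D C (partner (p i))
          j+1<n = <-trans (n<1+n (suc j)) i<n
          j<i = <-trans (n<1+n j) (n<1+n (suc j))
          pi<n = <-trans (p< (s≤s z≤n) i<n) i<n
          partner<i = partner< (p< (s≤s z≤n) i<n) i<n (s≤s (s≤s z≤n))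
          cong-retarget : ∀ {x₁ x₂ y₁ y₂ x'₁ x'₂ y'₁ y'₂ z} → x₁ ≡ x₂ → y₁ ≡ y₂ → x'₁ ≡ x'₂ → y'₁ ≡ y'₂ →
            retarget x₁ y₁ x'₁ y'₁ z ≡ retarget x₂ y₂ x'₂ y'₂ z
          cong-retarget refl refl refl refl = refl

avoid-two : ∀ {q'} (x y : Fin (suc (suc (suc q')))) → ∃ λ z → z ≢ x × z ≢ y
avoid-two x y with 0F ≟ x | 0F ≟ y
... | no 0≢x   | no 0≢y = 0F , 0≢x , 0≢y
... | yes refl | _ with 1F ≟ y
...   | no 1≢y   = 1F , (λ ()) , 1≢y
...   | yes refl = 2F , (λ ()) , (λ ())
avoid-two x y | no 0≢x | yes refl with 1F ≟ x
...   | no 1≢x   = 1F , 1≢x , (λ ())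
...   | yes refl = 2F , (λ ()) , (λ ())

-- A branching non-root position b with two children c₁ ≢ c₂ yields a 2-scf
-- colouring E of T (with q ≥ 3 colours) in which c₁ has the colour of the
-- parent of b: the children of b other than c₂ copy the colour of p b, and
-- every other position i ≥ 2 avoids the colours of p i and partner (p i).
module ExtraColouring {n q' : ℕ} {T : Graph n} {r : Fin n} (R : Rooted T r) (1<n : 1 < n)
  {b c₁ c₂ : ℕ} (0<b : 0 < b) (0<c₁ : 0 < c₁) (0<c₂ : 0 < c₂) (c₁<n : c₁ < n) (c₂<n : c₂ < n)
  (pc₁≡b : Rooted.p R c₁ ≡ b) (pc₂≡b : Rooted.p R c₂ ≡ b) (c₁≢c₂ : c₁ ≢ c₂) where

  open Rooted R
  open RootedColouring {q = suc (suc (suc q'))} R 1<n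

  private
    Q = suc (suc (suc q'))

    third : Fin Q → Fin Q → Fin Q
    third x y = proj₁ (avoid-two x y)

    third≢₁ : ∀ x y → third x y ≢ x
    third≢₁ x y = proj₁ (proj₂ (avoid-two x y))

    third≢₂ : ∀ x y → third x y ≢ y
    third≢₂ x y = proj₂ (proj₂ (avoid-two x y))

    child-of-b≥2 : ∀ {c} → 0 < c → p c ≡ b → c < n → 2 ≤ c
    child-of-b≥2 {c} 0<c pc≡b c<n = ≤-trans (s≤s 0<b) (subst (_< c) pc≡b (p< 0<c c<n))

  Special : ℕ → Set
  Special i = p i ≡ b × i ≢ c₂

  special? : Decidable Special
  special? i = (p i ℕₚ.≟ b) ×-dec ¬? (i ℕₚ.≟ c₂)

  rule : ℕ → (ℕ → Fin Q) → Fin Q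
  rule zero            _ = 0F
  rule (suc zero)      _ = 1F
  rule i@(suc (suc j)) g with special? i
  ... | yes _ = g (p b)
  ... | no _  = third (g (p i)) (g (partner (p i)))

  private
    rule-local : ∀ {i} (g h : ℕ → Fin Q) → i < n → (∀ {j} → j < i → g j ≡ h j) → rule i g ≡ rule i h
    rule-local {zero}        _ _ _   _ = refl
    rule-local {suc zero}    _ _ _   _ = refl
    rule-local {suc (suc j)} g h i<n agree with special? (suc (suc j))
    ... | yes (pi≡b , _) = agree (<-trans (p< 0<b b<n) (subst (_< suc (suc j)) pi≡b (p< (s≤s z≤n) i<n)))
      where b<n = <-trans (subst (_< c₁) pc₁≡b (p< 0<c₁ c₁<n)) c₁<n
    ... | no _ = cong₂ third (agree pi<i) (agree (partner< pi<i i<n (s≤s (s≤s z≤n))))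
      where pi<i = p< (s≤s z≤n) i<n

  open CourseOfValues n 0F rule rule-local public renaming (seq to E)

  E-special : ∀ {i} → 2 ≤ i → i < n → Special i → E i ≡ E (p b)
  E-special {suc zero} (s≤s ())
  E-special {suc (suc j)} _ i<n s with special? (suc (suc j)) | unfold i<n
  ... | yes _ | Ei≡ = Ei≡
  ... | no ¬s | _   = ⊥-elim (¬s s)

  E-partner : ∀ {i} → 2 ≤ i → i < n → ¬ Special i → E i ≢ E (partner (p i))
  E-partner {suc zero} (s≤s ())
  E-partner {suc (suc j)} _ i<n ¬s with special? (suc (suc j)) | unfold i<n
  ... | yes s | _   = ⊥-elim (¬s s)
  ... | no _  | Ei≡ = λ same → third≢₂ (E (p (suc (suc j)))) (E (partner (p (suc (suc j))))) (trans (sym Ei≡) same)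

  -- E differs along parent edges; for a special i this is E b ≢ E (p b).
  E-parent : ∀ {i} → 0 < i → i < n → E i ≢ E (p i)
  E-parent {i} = <-rec (λ i → 0 < i → i < n → E i ≢ E (p i)) differs i
    where
      differs : ∀ i → (∀ {k} → k < i → 0 < k → k < n → E k ≢ E (p k)) → 0 < i → i < n → E i ≢ E (p i)
      differs (suc zero) _ _ 1<n′ E1≡Ep1 with unfold 1<n′ | unfold (<-trans (s≤s z≤n) 1<n′)
      ... | E1≡1 | E0≡0 = 1≢0 (trans (sym E1≡1) (trans E1≡Ep1 (trans (cong E p1≡0) E0≡0)))
        where 1≢0 : 1F ≢ 0F
              1≢0 ()
      differs i@(suc (suc j)) ih _ i<n Ei≡Epi with special? i | unfold i<n
      ... | yes (pi≡b , _) | Ei≡ = ih b<i 0<b (<-trans b<i i<n)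
              (trans (cong E (sym pi≡b)) (trans (sym Ei≡Epi) Ei≡))
        where b<i = subst (_< i) pi≡b (p< (s≤s z≤n) i<n)
      ... | no _ | Ei≡ = third≢₁ (E (p i)) (E (partner (p i))) (trans (sym Ei≡) Ei≡Epi)

  -- E is 2-scf: S (partner m) is distinguished at every S m with m ≢ b, and
  -- S c₂ at S b, where all other neighbours carry the colour of p b.
  extra-scf : Is2SCF T (E ∘ index)
  extra-scf = scf-by-positions E E-parent distinguished
    where
      c₂-differs : E c₂ ≢ E (p b)
      c₂-differs same = E-partner (child-of-b≥2 0<c₂ pc₂≡b c₂<n) c₂<n (λ (_ , c₂≢c₂) → c₂≢c₂ refl)
        (trans same (cong E (trans (sym (partner-pos 0<b)) (cong partner (sym pc₂≡b)))))

      distinguished : ∀ {m} → m < n → ∃ (Distinguished T (E ∘ index) (S m))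
      distinguished {m} m<n with m ℕₚ.≟ b
      ... | no m≢b = _ , partner-distinguished E m<n λ 0<j j<n pj≡m j≢ same →
            E-partner (child≥2 0<j pj≡m j≢) j<n (λ (pj≡b , _) → m≢b (trans (sym pj≡m) pj≡b))
              (trans same (cong (E ∘ partner) (sym pj≡m)))
      ... | yes refl = S c₂ , b~c₂ , only-c₂
        where
          b~c₂ : adj T (S b) (S c₂) ≡ true
          b~c₂ = subst (λ z → adj T (S z) (S c₂) ≡ true) pc₂≡b (parent-edge 0<c₂ c₂<n)

          only-c₂ : ∀ u → adj T (S b) u ≡ true → E (index u) ≡ E (index (S c₂)) → u ≡ S c₂
          only-c₂ u b~u same with neighbour-cases m<n b~u
          ... | inj₂ (_ , u≡S) = ⊥-elim (c₂-differs (sym (trans (cong E (sym (trans (cong index u≡S)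
                  (index-S (<-trans (p< 0<b m<n) m<n))))) (trans same (cong E (index-S c₂<n))))))
          ... | inj₁ (0<j , pj≡b) with index u ℕₚ.≟ c₂
          ...   | yes j≡c₂ = trans (sym (S-index u)) (cong S j≡c₂)
          ...   | no j≢c₂  = ⊥-elim (c₂-differs (trans (sym (trans same (cong E (index-S c₂<n))))
                  (E-special (child-of-b≥2 0<j pj≡b (index<n u)) (index<n u) (pj≡b , j≢c₂))))

  c₁≥2 : 2 ≤ c₁
  c₁≥2 = child-of-b≥2 0<c₁ pc₁≡b c₁<n

  E-c₁ : E c₁ ≡ E (partner (p c₁))
  E-c₁ = trans (E-special c₁≥2 c₁<n (pc₁≡b , c₁≢c₂)) (cong E (trans (sym (partner-pos 0<b)) (cong partner (sym pc₁≡b))))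

-- Rooting a tree at a leaf: the last vertex of a rooted ordering has no
-- children, so rooted there the root has exactly one child.
module LeafRooted {m : ℕ} (T : Graph (suc m)) (tree : IsTree T) where

  private
    R₀ = rooted T tree 0F
    module R₀ = Rooted R₀

    leaf : Fin (suc m)
    leaf = R₀.S m

    leaf-neighbour : ∀ {u} → adj T leaf u ≡ true → u ≡ R₀.S (R₀.p m)
    leaf-neighbour {u} leaf~u with R₀.neighbour-cases ≤-refl leaf~u
    ... | inj₁ (0<j , pj≡m) = ⊥-elim (<-irrefl refl (<-≤-trans (subst (_< R₀.index u) pj≡m (R₀.p< 0<j (R₀.index<n u)))
            (≤-pred (R₀.index<n u))))
    ... | inj₂ (_ , u≡S) = u≡S

  R : Rooted T leaf
  R = rooted T tree leaf

  open Rooted R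

  -- Children of the root are neighbours of the leaf, hence all equal.
  root-one-child : ∀ {j k} → 0 < j → 0 < k → j < suc m → k < suc m → p j ≡ 0 → p k ≡ 0 → j ≡ k
  root-one-child 0<j 0<k j<n k<n pj≡0 pk≡0 =
    S-injective j<n k<n (trans (leaf-neighbour (root~ 0<j j<n pj≡0)) (sym (leaf-neighbour (root~ 0<k k<n pk≡0))))
    where
      root~ : ∀ {j} → 0 < j → j < suc m → p j ≡ 0 → adj T leaf (S j) ≡ true
      root~ {j} 0<j j<n pj≡0 = subst (λ z → adj T z (S j) ≡ true) (trans (cong S pj≡0) S-root) (parent-edge 0<j j<n)

true-iff⇒≡ : ∀ {x y : Bool} → (x ≡ true → y ≡ true) → (y ≡ true → x ≡ true) → x ≡ y
true-iff⇒≡ {true}           x⇒y _   = sym (x⇒y refl)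
true-iff⇒≡ {false} {false}  _   _   = refl
true-iff⇒≡ {false} {true}   _   y⇒x = y⇒x refl

module AtLeastTwoVertices {m q' : ℕ} (T : Graph (suc (suc m))) (tree : IsTree T) where

  private
    n = suc (suc m)
    Q = suc (suc (suc q'))

    1<n : 1 < n
    1<n = s≤s (s≤s z≤n)

  open LeafRooted T tree
  open Rooted R
  open RootedColouring {q = Q} R 1<n

  Φ : (Fin n → Fin Q) → (Fin n → Fin Q)
  Φ c = Transport.D (c ∘ at) ∘ index

  private
    Φ-at : ∀ {c : Fin n → Fin Q} {e : ℕ → Fin Q} → Φ c ≗ e ∘ index → ∀ {i} → i < n → Transport.D (c ∘ at) i ≡ e i
    Φ-at {c} {e} Φc≗e {i} i<n = subst (λ j → Transport.D (c ∘ at) j ≡ e j) (index-S i<n) (Φc≗e (S i))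

  Φ-injective : ∀ {c c'} → Φ c ≗ Φ c' → c ≗ c'
  Φ-injective {c} {c'} Φc≗Φc' x = begin
    c x                ≡⟨ cong c (sym (at-toℕ x)) ⟩
    c (at (toℕ x))     ≡⟨ transport-injective (Φ-at {c} {Transport.D (c' ∘ at)} Φc≗Φc') (toℕ<n x) ⟩
    c' (at (toℕ x))    ≡⟨ cong c' (at-toℕ x) ⟩
    c' x               ∎

  Φ-scf : ∀ c → Is2SCF (P n) c → Is2SCF T (Φ c)
  Φ-scf c scf = Transport.transported-scf (c ∘ at) (path-spread c scf)

  path≤tree : χ2scf (P n) Q ≤ χ2scf T Q
  path≤tree = χ-≤ (P n) T Φ Φ-injective Φ-scf

  Siblings : ℕ → ℕ → Set
  Siblings c₁ c₂ = 0 < c₁ × 0 < c₂ × c₁ ≢ c₂ × p c₁ ≡ p c₂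

  Branching : Set
  Branching = ∃ λ c₁ → c₁ < n × ∃ λ c₂ → c₂ < n × Siblings c₁ c₂

  branching? : Dec Branching
  branching? = anyUpTo? (λ c₁ → anyUpTo? (siblings? c₁) n) n
    where
      siblings? : ∀ c₁ → Decidable (Siblings c₁)
      siblings? c₁ c₂ = (0 <? c₁) ×-dec (0 <? c₂) ×-dec ¬? (c₁ ℕₚ.≟ c₂) ×-dec (p c₁ ℕₚ.≟ p c₂)

  branching⇒< : Branching → χ2scf (P n) Q < χ2scf T Q
  branching⇒< (c₁ , c₁<n , c₂ , c₂<n , 0<c₁ , 0<c₂ , c₁≢c₂ , same-parent) =
    χ-< (P n) T Φ Φ-injective Φ-scf (E ∘ index) extra-scf not-transported
    where
      -- the root has only one child, so the common parent is not the root
      0<b : 0 < p c₁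
      0<b with p c₁ ℕₚ.≟ 0
      ... | yes pc₁≡0 = ⊥-elim (c₁≢c₂ (root-one-child 0<c₁ 0<c₂ c₁<n c₂<n pc₁≡0 (trans (sym same-parent) pc₁≡0)))
      ... | no pc₁≢0  = ℕₚ.n≢0⇒n>0 pc₁≢0

      open ExtraColouring {q' = q'} R 1<n 0<b 0<c₁ 0<c₂ c₁<n c₂<n refl (sym same-parent) c₁≢c₂

      -- transported colourings never repeat the grand-partner colour, but E does at c₁
      not-transported : ∀ c → Is2SCF (P n) c → ¬ (Φ c ≗ E ∘ index)
      not-transported c scf Φc≗E = Transport.D-partner (c ∘ at) (path-spread c scf) c₁≥2 c₁<n (begin
        D c₁                   ≡⟨ Φ-at {c} {E} Φc≗E c₁<n ⟩
        E c₁                   ≡⟨ E-c₁ ⟩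
        E (partner (p c₁))     ≡⟨ sym (Φ-at {c} {E} Φc≗E (partner<n (<-trans (p< 0<c₁ c₁<n) c₁<n))) ⟩
        D (partner (p c₁))     ∎)
        where D = Transport.D (c ∘ at)

  parent-is-previous : ¬ Branching → ∀ {i} → 0 < i → i < n → suc (p i) ≡ i
  parent-is-previous no-branching {i} = <-rec (λ i → 0 < i → i < n → suc (p i) ≡ i) previous i
    where
      previous : ∀ i → (∀ {k} → k < i → 0 < k → k < n → suc (p k) ≡ k) → 0 < i → i < n → suc (p i) ≡ i
      previous (suc i') ih 0<i i<n with m<1+n⇒m<n∨m≡n (p< 0<i i<n)
      ... | inj₂ pi≡i' = cong suc pi≡i'
      ... | inj₁ pi<i' = ⊥-elim (no-branching (suc i' , i<n , suc (p (suc i')) , k<n ,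
              0<i , s≤s z≤n , (λ e → <-irrefl (sym e) (s≤s pi<i')) , sym (ℕₚ.suc-injective (ih (s≤s pi<i') (s≤s z≤n) k<n))))
        where k<n = <-trans (s≤s pi<i') i<n

  unbranched⇒path : ¬ Branching → T ≅ P n
  unbranched⇒path no-branching = permutation σ σ⁻ σσ⁻ σ⁻σ , adj-σ
    where
      σ σ⁻ : Fin n → Fin n
      σ  i = S (toℕ i)
      σ⁻ x = at (index x)

      σσ⁻ : ∀ x → σ (σ⁻ x) ≡ x
      σσ⁻ x = trans (cong S (toℕ-at (index x) (index<n x))) (S-index x)

      σ⁻σ : ∀ i → σ⁻ (σ i) ≡ i
      σ⁻σ i = trans (cong at (index-S (toℕ<n i))) (at-toℕ i)

      previous = parent-is-previous no-branching

      step-edge : ∀ {i j : Fin n} → suc (toℕ i) ≡ toℕ j → adj T (σ i) (σ j) ≡ true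
      step-edge {i} {j} e = subst (λ z → adj T (S z) (σ j) ≡ true)
        (ℕₚ.suc-injective (trans (previous 0<j (toℕ<n j)) (sym e))) (parent-edge 0<j (toℕ<n j))
        where 0<j = subst (0 <_) e (s≤s z≤n)

      adj-σ : ∀ i j → adj T (σ i) (σ j) ≡ adj (P n) i j
      adj-σ i j = true-iff⇒≡ to from
        where
          to : adj T (σ i) (σ j) ≡ true → adj (P n) i j ≡ true
          to i~j with only-parent-edges (toℕ<n i) (toℕ<n j) i~j
          ... | inj₁ (0<j , pj≡i) = P-adj⁺ (trans (cong suc (sym pj≡i)) (previous 0<j (toℕ<n j)))
          ... | inj₂ (0<i , pi≡j) = trans (adj-sym (P n) i j) (P-adj⁺ (trans (cong suc (sym pi≡j)) (previous 0<i (toℕ<n i))))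
          from : adj (P n) i j ≡ true → adj T (σ i) (σ j) ≡ true
          from i~j with P-adj⁻ i~j
          ... | inj₁ e = step-edge e
          ... | inj₂ e = trans (adj-sym T (σ i) (σ j)) (step-edge e)

  -- Equality rules out branching, and an unbranched tree is a path.
  theorem : (χ2scf (P n) Q ≤ χ2scf T Q) × ((χ2scf (P n) Q ≡ χ2scf T Q) ⇔ (T ≅ P n))
  theorem = path≤tree , mk⇔ equal⇒path (λ T≅P → ≤-antisym path≤tree (χ-≤-of-≅ Q T (P n) T≅P))
    where
      equal⇒path : χ2scf (P n) Q ≡ χ2scf T Q → T ≅ P n
      equal⇒path eq with branching?
      ... | yes branching    = ⊥-elim (<-irrefl eq (branching⇒< branching))
      ... | no no-branching  = unbranched⇒path no-branching

-- On a single vertex there are no edges, so every graph is P 1.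
single-vertex : ∀ q (T : Graph 1) →
  (χ2scf (P 1) q ≤ χ2scf T q) × ((χ2scf (P 1) q ≡ χ2scf T q) ⇔ (T ≅ P 1))
single-vertex q T = χ-≤-of-≅ q (P 1) T P≅T , mk⇔ (λ _ → T≅P) λ T≅P′ →
  ≤-antisym (χ-≤-of-≅ q (P 1) T P≅T) (χ-≤-of-≅ q T (P 1) T≅P′)
  where
    no-edges : ∀ (G : Graph 1) i j → adj G i j ≡ false
    no-edges G 0F 0F = adj-irr G 0F

    P≅T : P 1 ≅ T
    P≅T = Perm.id , λ i j → trans (no-edges (P 1) i j) (sym (no-edges T i j))

    T≅P : T ≅ P 1
    T≅P = Perm.id , λ i j → trans (no-edges T i j) (sym (no-edges (P 1) i j))

theorem2p10 : (q n : ℕ) → 3 ≤ q → 1 ≤ n → (T : Graph n) → IsTree T →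
    (χ2scf (P n) q ≤ χ2scf T q) × ((χ2scf (P n) q ≡ χ2scf T q) ⇔ (T ≅ P n))
theorem2p10 q                    (suc zero)    _                    _ T _    = single-vertex q T
theorem2p10 (suc (suc (suc q'))) (suc (suc m)) _                    _ T tree = AtLeastTwoVertices.theorem T tree
theorem2p10 (suc (suc zero))     (suc (suc m)) (s≤s (s≤s ()))       _ _ _
theorem2p10 (suc zero)           (suc (suc m)) (s≤s ())             _ _ _
theorem2p10 zero                 (suc (suc m)) ()                   _ _ _
theorem2p10 q                    zero          _                    () _ _
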